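{- Let $C=(V_c,E_c)$ be a cactus graph and let $C_L=(V_c,L_c)$ be the link graph of $C$ with link cost function $c:L_c\to\mathbb{R}_{\geq 0}$, and suppose that a feasible solution to the weighted connectivity augmentation problem on $C$ with link set $L_c$ exists. Then any minimum spanning forest $L_{MST}\subseteq L_c$ of $C_L$ (with respect to the costs $c$) is a feasible solution to the weighted connectivity augmentation problem on $C$.
   Context: A cactus graph is a connected graph in which any two cycles share at most one vertex. A cut of a graph with vertex set $V$ is a bipartition of $V$ into two nonempty sets; its size (weight) is the number (total weight) of edges with one endpoint on each side, and a minimum cut is a cut of minimum size/weight. Given a graph $H=(V,E)$ and a set of links $L\subseteq\binom{V}{2}$ disjoint from $E$ with costs $c:L\to\mathbb{R}_{\ge0}$, a link $uv$ covers a minimum cut of $H$ if $u$ and $v$ lie on different sides of it. The weighted connectivity augmentation problem (WCAP) on $H$ asks for a minimum-cost set $S\subseteq L$ such that the edge connectivity of $(V,E\cup S)$ is one larger than that of $H$; a feasible solution is any $S\subseteq L$ with this property, equivalently any $S$ such that every minimum cut of $H$ is covered by some link of $S$. The link graph of the cactus is the graph $C_L=(V_c,L_c)$ formed by the vertices of the cactus and the available links. A minimum spanning forest of $C_L$ is a minimum-cost spanning tree of each connected component of $C_L$.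
   Formalization: The link costs c take nonnegative rational values instead of real ones. -}

module Defs where

open import Data.Nat as ℕ using (ℕ; zero; suc)
open import Data.Fin using (Fin; toℕ; fromℕ<)
import Data.Fin as F
open import Data.Bool using (Bool; true; false; if_then_else_; _xor_)
open import Data.List using (List; foldr; map; allFin)
open import Data.Product using (_×_; _,_; proj₁; proj₂; ∃; Σ)
open import Data.Sum using (_⊎_)
open import Data.Unit using (⊤)
open import Relation.Binary.PropositionalEquality using (_≡_; _≢_)
open import Relation.Nullary using (¬_; yes; no)
open import Function using (_⇔_)
open import Function.Definitions using (Injective)
open import Data.Rational as ℚ using (ℚ; 0ℚ)

-- Vertices are Fin n.  A (multi)graph with p edges is a map  Fin p → Fin n × Fin n
-- (edge i has the two endpoints E i; parallel edges are allowed).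

Joins : ∀ {n} → Fin n × Fin n → Fin n → Fin n → Set
Joins (u , v) a b = (u ≡ a × v ≡ b) ⊎ (u ≡ b × v ≡ a)

data Reach {n p : ℕ} (E : Fin p → Fin n × Fin n) (P : Fin p → Set) : Fin n → Fin n → Set where
  here : ∀ {x} → Reach E P x x
  step : ∀ {x y z} (i : Fin p) → P i → Joins (E i) x y → Reach E P y z → Reach E P x z

AllEdges : ∀ {p} → Fin p → Set
AllEdges _ = ⊤

Connected : ∀ {n p} → (Fin p → Fin n × Fin n) → Set
Connected {n} E = ∀ (u v : Fin n) → Reach E AllEdges u v

cycSuc : ∀ {k} → Fin (suc k) → Fin (suc k)
cycSuc {k} i with suc (toℕ i) ℕ.<? suc k
... | yes lt = fromℕ< lt
... | no _ = F.zero

record Cycle {n p : ℕ} (E : Fin p → Fin n × Fin n) (P : Fin p → Set) : Set where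
  field
    len-2   : ℕ
    vtx     : Fin (suc (suc len-2)) → Fin n
    edg     : Fin (suc (suc len-2)) → Fin p
    vtx-inj : Injective _≡_ _≡_ vtx
    edg-inj : Injective _≡_ _≡_ edg
    edg-P   : ∀ i → P (edg i)
    joins   : ∀ i → Joins (E (edg i)) (vtx i) (vtx (cycSuc i))

OnCycle : ∀ {n p E P} → Fin n → Cycle {n} {p} E P → Set
OnCycle x C = ∃ λ i → Cycle.vtx C i ≡ x

EdgeOf : ∀ {n p E P} → Fin p → Cycle {n} {p} E P → Set
EdgeOf e C = ∃ λ i → Cycle.edg C i ≡ e

SameCycle : ∀ {n p E P} → Cycle {n} {p} E P → Cycle E P → Set
SameCycle C D = ∀ e → EdgeOf e C ⇔ EdgeOf e D

-- cactus: connected, and any two (distinct) cycles share at most one vertex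
Cactus : ∀ {n p} → (Fin p → Fin n × Fin n) → Set
Cactus {n} E = Connected E ×
  (∀ (C D : Cycle E AllEdges) (x y : Fin n) → x ≢ y →
     OnCycle x C → OnCycle y C → OnCycle x D → OnCycle y D → SameCycle C D)

IsCut : ∀ {n} → (Fin n → Bool) → Set
IsCut {n} S = (∃ λ x → S x ≡ true) × (∃ λ y → S y ≡ false)

Crosses : ∀ {n} → (Fin n → Bool) → Fin n × Fin n → Bool
Crosses S (u , v) = S u xor S v

cutSize : ∀ {n p} → (Fin p → Fin n × Fin n) → (Fin n → Bool) → ℕ
cutSize {p = p} E S = foldr ℕ._+_ 0 (map (λ i → if Crosses S (E i) then 1 else 0) (allFin p))

MinCut : ∀ {n p} → (Fin p → Fin n × Fin n) → (Fin n → Bool) → Set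
MinCut E S = IsCut S × (∀ T → IsCut T → cutSize E S ℕ.≤ cutSize E T)

InSet : ∀ {m} → (Fin m → Bool) → Fin m → Set
InSet F i = F i ≡ true

-- feasible WCAP solution: every minimum cut of H is covered by a chosen link
Feasible : ∀ {n p m} → (Fin p → Fin n × Fin n) → (Fin m → Fin n × Fin n) → (Fin m → Bool) → Set
Feasible E L F = ∀ S → MinCut E S → ∃ λ i → F i ≡ true × Crosses S (L i) ≡ true

ValidLinks : ∀ {n p m} → (Fin p → Fin n × Fin n) → (Fin m → Fin n × Fin n) → Set
ValidLinks E L =
  (∀ i → proj₁ (L i) ≢ proj₂ (L i)) ×
  (∀ i j → Joins (L i) (proj₁ (L j)) (proj₂ (L j)) → i ≡ j) ×
  (∀ i e → ¬ Joins (L i) (proj₁ (E e)) (proj₂ (E e)))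

cost : ∀ {m} → (Fin m → ℚ) → (Fin m → Bool) → ℚ
cost {m} c F = foldr ℚ._+_ 0ℚ (map (λ i → if F i then c i else 0ℚ) (allFin m))

SpanningForest : ∀ {n m} → (Fin m → Fin n × Fin n) → (Fin m → Bool) → Set
SpanningForest {n} L F =
  ¬ Cycle L (InSet F) ×
  (∀ (u v : Fin n) → Reach L AllEdges u v → Reach L (InSet F) u v)

MinSpanningForest : ∀ {n m} → (Fin m → Fin n × Fin n) → (Fin m → ℚ) → (Fin m → Bool) → Set
MinSpanningForest L c F =
  SpanningForest L F × (∀ G → SpanningForest L G → cost c F ℚ.≤ cost c G)

{-# OPTIONS --safe #-}
module Submission where

-- The endpoints of any link u v are joined by a path of links of a spanning forest F of the link
-- graph.  If u v crosses a cut, the side changes somewhere along that path, so some link of F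
-- crosses the cut too.  Hence F covers every cut covered by any feasible solution.

open import Defs
open import Data.Nat using (ℕ)
open import Data.Fin using (Fin)
open import Data.Bool using (Bool; true; false; _xor_)
open import Data.Bool.Properties using (xor-same)
open import Data.Product using (_×_; ∃; _,_; proj₁; proj₂)
open import Data.Sum using (inj₁; inj₂)
open import Data.Unit using (tt)
open import Data.Rational using (ℚ; 0ℚ; _≤_)
open import Relation.Binary.PropositionalEquality using (_≡_; refl; sym; trans; subst)

xor≡false⇒≡ : ∀ a b → a xor b ≡ false → a ≡ b
xor≡false⇒≡ false false _ = refl
xor≡false⇒≡ true  true  _ = refl

Joins-¬Crosses⇒≡ : ∀ {n} (S : Fin n → Bool) e {x y} →
  Joins e x y → Crosses S e ≡ false → S x ≡ S y
Joins-¬Crosses⇒≡ S _ (inj₁ (refl , refl)) h = xor≡false⇒≡ _ _ h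
Joins-¬Crosses⇒≡ S _ (inj₂ (refl , refl)) h = sym (xor≡false⇒≡ _ _ h)

Reach-Crosses : ∀ {n p} {E : Fin p → Fin n × Fin n} {P : Fin p → Set} (S : Fin n → Bool) {x z} →
  Reach E P x z → Crosses S (x , z) ≡ true → ∃ λ i → P i × Crosses S (E i) ≡ true
Reach-Crosses S {x} here h with () ← trans (sym (xor-same (S x))) h
Reach-Crosses {E = E} S {z = z} (step i Pi xy r) h with Crosses S (E i) in eq
... | true  = i , Pi , eq
... | false = Reach-Crosses S r (subst (λ b → b xor S z ≡ true) (Joins-¬Crosses⇒≡ S (E i) xy eq) h)

Reach-endpoints : ∀ {n p} {E : Fin p → Fin n × Fin n} {P : Fin p → Set} i →
  P i → Reach E P (proj₁ (E i)) (proj₂ (E i))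
Reach-endpoints i Pi = step i Pi (inj₁ (refl , refl)) here

SpanningForest-Reach-endpoints : ∀ {n m} {L : Fin m → Fin n × Fin n} {F : Fin m → Bool} →
  SpanningForest L F → ∀ i → Reach L (InSet F) (proj₁ (L i)) (proj₂ (L i))
SpanningForest-Reach-endpoints (_ , spans) i = spans _ _ (Reach-endpoints i tt)

SpanningForest-Feasible : ∀ {n p m} (E : Fin p → Fin n × Fin n) {L : Fin m → Fin n × Fin n} {F S : Fin m → Bool} →
  SpanningForest L F → Feasible E L S → Feasible E L F
SpanningForest-Feasible _ forest feasible T minCut with feasible T minCut
... | i , _ , crosses = Reach-Crosses T (SpanningForest-Reach-endpoints forest i) crosses

theorem2 : ∀ {n p m : ℕ} (E : Fin p → Fin n × Fin n) (L : Fin m → Fin n × Fin n) (c : Fin m → ℚ) →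
    Cactus E → ValidLinks E L → (∀ i → 0ℚ ≤ c i) →
    (∃ λ S → Feasible E L S) →
    ∀ (F : Fin m → Bool) → MinSpanningForest L c F → Feasible E L F
theorem2 E L c _ _ _ (_ , feasible) F (forest , _) = SpanningForest-Feasible E forest feasible
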